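{- In a linearly closed Cartesian differential category: (i) for maps $f,g:A\to B$, $\mathbf{J}(f+g)=\mathbf{J}(f)+\mathbf{J}(g)$ and $\mathbf{J}(0)=0$; (ii) if $f:A\to B$ is linear, then $\mathbf{J}(f)=p_f\circ 0$, where $0:A\to\top$; (iii) for maps $f:A\to B$ and $g:B\to C$, $\mathbf{J}(g\circ f)=\odot\circ\langle\mathbf{J}(g)\circ f,\mathbf{J}(f)\rangle$.
   Context: A Cartesian left additive category is a category with chosen finite products (binary product $\times$, projections $\pi_0,\pi_1$, pairing $\langle-,-\rangle$, terminal object $\top$) in which every hom-set is a commutative monoid $(+,0)$, precomposition preserves the structure ($(f+g)\circ a=f\circ a+g\circ a$, $0\circ a=0$), and projections are additive. Write $f\times g=\langle f\circ\pi_0,g\circ\pi_1\rangle$. A Cartesian differential category is a Cartesian left additive category with an operator $\mathsf{D}$ sending $f:A\to B$ to $\mathsf{D}[f]:A\times A\to B$ such that: [CD.1] $\mathsf{D}[f+g]=\mathsf{D}[f]+\mathsf{D}[g]$, $\mathsf{D}[0]=0$; [CD.2] $\mathsf{D}[f]\circ\langle a,b+c\rangle=\mathsf{D}[f]\circ\langle a,b\rangle+\mathsf{D}[f]\circ\langle a,c\rangle$, $\mathsf{D}[f]\circ\langle a,0\rangle=0$; [CD.3] $\mathsf{D}[1_A]=\pi_1$, $\mathsf{D}[\pi_j]=\pi_j\circ\pi_1$; [CD.4] $\mathsf{D}[\langle f,g\rangle]=\langle\mathsf{D}[f],\mathsf{D}[g]\rangle$; [CD.5] $\mathsf{D}[g\circ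 f]=\mathsf{D}[g]\circ\langle f\circ\pi_0,\mathsf{D}[f]\rangle$; [CD.6] $\mathsf{D}[\mathsf{D}[f]]\circ\langle\langle a,b\rangle,\langle 0,c\rangle\rangle=\mathsf{D}[f]\circ\langle a,c\rangle$; [CD.7] $\mathsf{D}[\mathsf{D}[f]]\circ\langle\langle a,b\rangle,\langle c,0\rangle\rangle=\mathsf{D}[\mathsf{D}[f]]\circ\langle\langle a,c\rangle,\langle b,0\rangle\rangle$. A map $f:A\to B$ is linear if $\mathsf{D}[f]\circ\langle a,b\rangle=f\circ b$ for all $a,b$. A map $f:A\times B\to C$ is linear in its second argument if $\mathsf{D}[f]\circ\langle\langle a,b\rangle,\langle 0,d\rangle\rangle=f\circ\langle a,d\rangle$ for all $a,b,d$, linear in its first argument if $\mathsf{D}[f]\circ\langle\langle a,b\rangle,\langle c,0\rangle\rangle=f\circ\langle c,b\rangle$ for all $a,b,c$, bilinear if both. A linearly closed Cartesian differential category is a Cartesian differential category with, for each $A,B$, an object $\mathcal{L}(A,B)$ and a bilinear $\varepsilon_\ell:\mathcal{L}(A,B)\times A\to B$ such that every $f:A\times B\to C$ linear in its second argument has a unique $\lambda_\ell(f):A\to\mathcal{L}(B,C)$ with $f=\varepsilon_\ell\circ(\lambda_\ell(f)\times 1_B)$. The Jacobian of $f:A\to B$ is $\mathbf{J}(f):=\lambda_\ell(\mathsf{D}[f]):A\to\mathcal{L}(A,B)$ (by [CD.6], $\mathsf{D}[f]$ is linear in its second argument). For a linear $f:A\to B$, $p_f:\top\to\mathcal{L}(A,B)$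 is the linear curry of $f\circ\pi_1:\top\times A\to B$. The map $\odot:\mathcal{L}(B,C)\times\mathcal{L}(A,B)\to\mathcal{L}(A,C)$ is the linear curry of $\varepsilon_\ell\circ\langle\pi_0\circ\pi_0,\varepsilon_\ell\circ\langle\pi_1\circ\pi_0,\pi_1\rangle\rangle:(\mathcal{L}(B,C)\times\mathcal{L}(A,B))\times A\to C$. -}

module Defs where

open import Level using (Level; _⊔_; suc)
open import Relation.Binary using (Rel; IsEquivalence)
open import Data.Product using (_×_; _,_)

record CLACat (o ℓ e : Level) : Set (suc (o ⊔ ℓ ⊔ e)) where
  infixr 9 _∘_
  infix  4 _≈_
  infixl 6 _+_
  field
    Obj  : Set o
    Hom  : Obj → Obj → Set ℓ
    _≈_  : ∀ {A B} → Rel (Hom A B) e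
    ≈-equiv : ∀ {A B} → IsEquivalence (_≈_ {A} {B})
    id   : ∀ {A} → Hom A A
    _∘_  : ∀ {A B C} → Hom B C → Hom A B → Hom A C
    ∘-resp-≈ : ∀ {A B C} {f f' : Hom B C} {g g' : Hom A B} → f ≈ f' → g ≈ g' → f ∘ g ≈ f' ∘ g'
    assoc    : ∀ {A B C D} {f : Hom C D} {g : Hom B C} {h : Hom A B} → (f ∘ g) ∘ h ≈ f ∘ (g ∘ h)
    identityˡ : ∀ {A B} {f : Hom A B} → id ∘ f ≈ f
    identityʳ : ∀ {A B} {f : Hom A B} → f ∘ id ≈ f
    ⊤    : Obj
    !    : ∀ {A} → Hom A ⊤
    !-unique : ∀ {A} (h : Hom A ⊤) → h ≈ !
    _⊗_  : Obj → Obj → Obj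
    π₀   : ∀ {A B} → Hom (A ⊗ B) A
    π₁   : ∀ {A B} → Hom (A ⊗ B) B
    ⟨_,_⟩ : ∀ {A B C} → Hom C A → Hom C B → Hom C (A ⊗ B)
    π₀-β : ∀ {A B C} {f : Hom C A} {g : Hom C B} → π₀ ∘ ⟨ f , g ⟩ ≈ f
    π₁-β : ∀ {A B C} {f : Hom C A} {g : Hom C B} → π₁ ∘ ⟨ f , g ⟩ ≈ g
    ⟨⟩-unique : ∀ {A B C} {f : Hom C A} {g : Hom C B} {h : Hom C (A ⊗ B)} →
                π₀ ∘ h ≈ f → π₁ ∘ h ≈ g → h ≈ ⟨ f , g ⟩
    _+_  : ∀ {A B} → Hom A B → Hom A B → Hom A B
    0h   : ∀ {A B} → Hom A B
    +-resp-≈ : ∀ {A B} {f f' g g' : Hom A B} → f ≈ f' → g ≈ g' → f + g ≈ f' + g'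
    +-assoc  : ∀ {A B} {f g h : Hom A B} → (f + g) + h ≈ f + (g + h)
    +-comm   : ∀ {A B} {f g : Hom A B} → f + g ≈ g + f
    +-identityˡ : ∀ {A B} {f : Hom A B} → 0h + f ≈ f
    +-∘ : ∀ {A B C} {f g : Hom B C} {a : Hom A B} → (f + g) ∘ a ≈ f ∘ a + g ∘ a
    0-∘ : ∀ {A B C} {a : Hom A B} → 0h {B} {C} ∘ a ≈ 0h
    π₀-+ : ∀ {A B C} {f g : Hom C (A ⊗ B)} → π₀ ∘ (f + g) ≈ π₀ ∘ f + π₀ ∘ g
    π₀-0 : ∀ {A B C} → π₀ ∘ 0h {C} {A ⊗ B} ≈ 0h
    π₁-+ : ∀ {A B C} {f g : Hom C (A ⊗ B)} → π₁ ∘ (f + g) ≈ π₁ ∘ f + π₁ ∘ g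
    π₁-0 : ∀ {A B C} → π₁ ∘ 0h {C} {A ⊗ B} ≈ 0h

  infixr 7 _⊗₁_
  _⊗₁_ : ∀ {A B C D} → Hom A C → Hom B D → Hom (A ⊗ B) (C ⊗ D)
  f ⊗₁ g = ⟨ f ∘ π₀ , g ∘ π₁ ⟩

record CDC (o ℓ e : Level) : Set (suc (o ⊔ ℓ ⊔ e)) where
  field
    cla : CLACat o ℓ e
  open CLACat cla public
  field
    D : ∀ {A B} → Hom A B → Hom (A ⊗ A) B
    D-resp-≈ : ∀ {A B} {f g : Hom A B} → f ≈ g → D f ≈ D g
    CD1-+ : ∀ {A B} {f g : Hom A B} → D (f + g) ≈ D f + D g
    CD1-0 : ∀ {A B} → D (0h {A} {B}) ≈ 0h
    CD2-+ : ∀ {A B X} {f : Hom A B} {a b c : Hom X A} →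
            D f ∘ ⟨ a , b + c ⟩ ≈ D f ∘ ⟨ a , b ⟩ + D f ∘ ⟨ a , c ⟩
    CD2-0 : ∀ {A B X} {f : Hom A B} {a : Hom X A} → D f ∘ ⟨ a , 0h ⟩ ≈ 0h
    CD3-id : ∀ {A} → D (id {A}) ≈ π₁
    CD3-π₀ : ∀ {A B} → D (π₀ {A} {B}) ≈ π₀ ∘ π₁
    CD3-π₁ : ∀ {A B} → D (π₁ {A} {B}) ≈ π₁ ∘ π₁
    CD4 : ∀ {A B C} {f : Hom A B} {g : Hom A C} → D ⟨ f , g ⟩ ≈ ⟨ D f , D g ⟩
    CD5 : ∀ {A B C} {f : Hom A B} {g : Hom B C} → D (g ∘ f) ≈ D g ∘ ⟨ f ∘ π₀ , D f ⟩
    CD6 : ∀ {A B X} {f : Hom A B} {a b c : Hom X A} →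
          D (D f) ∘ ⟨ ⟨ a , b ⟩ , ⟨ 0h , c ⟩ ⟩ ≈ D f ∘ ⟨ a , c ⟩
    CD7 : ∀ {A B X} {f : Hom A B} {a b c : Hom X A} →
          D (D f) ∘ ⟨ ⟨ a , b ⟩ , ⟨ c , 0h ⟩ ⟩ ≈ D (D f) ∘ ⟨ ⟨ a , c ⟩ , ⟨ b , 0h ⟩ ⟩

  -- linear maps and (bi)linearity in arguments ("for all a, b, ..." ranges over
  -- generalized elements X → _ for arbitrary X)
  IsLinear : ∀ {A B} → Hom A B → Set (o ⊔ ℓ ⊔ e)
  IsLinear {A} f = ∀ {X} (a b : Hom X A) → D f ∘ ⟨ a , b ⟩ ≈ f ∘ b

  LinearIn₂ : ∀ {A B C} → Hom (A ⊗ B) C → Set (o ⊔ ℓ ⊔ e)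
  LinearIn₂ {A} {B} f = ∀ {X} (a : Hom X A) (b d : Hom X B) →
    D f ∘ ⟨ ⟨ a , b ⟩ , ⟨ 0h , d ⟩ ⟩ ≈ f ∘ ⟨ a , d ⟩

  LinearIn₁ : ∀ {A B C} → Hom (A ⊗ B) C → Set (o ⊔ ℓ ⊔ e)
  LinearIn₁ {A} {B} f = ∀ {X} (a c : Hom X A) (b : Hom X B) →
    D f ∘ ⟨ ⟨ a , b ⟩ , ⟨ c , 0h ⟩ ⟩ ≈ f ∘ ⟨ c , b ⟩

  Bilinear : ∀ {A B C} → Hom (A ⊗ B) C → Set (o ⊔ ℓ ⊔ e)
  Bilinear f = LinearIn₁ f × LinearIn₂ f

record LinClosedCDC (o ℓ e : Level) : Set (suc (o ⊔ ℓ ⊔ e)) where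
  field
    cdc : CDC o ℓ e
  open CDC cdc public
  field
    L   : Obj → Obj → Obj
    εℓ  : ∀ {A B} → Hom (L A B ⊗ A) B
    εℓ-bilinear : ∀ {A B} → Bilinear (εℓ {A} {B})
    λℓ  : ∀ {A B C} (f : Hom (A ⊗ B) C) → LinearIn₂ f → Hom A (L B C)
    λℓ-β : ∀ {A B C} (f : Hom (A ⊗ B) C) (q : LinearIn₂ f) →
           f ≈ εℓ ∘ (λℓ f q ⊗₁ id)
    λℓ-unique : ∀ {A B C} (f : Hom (A ⊗ B) C) (q : LinearIn₂ f) (h : Hom A (L B C)) →
                f ≈ εℓ ∘ (h ⊗₁ id) → h ≈ λℓ f q

  D-linearIn₂ : ∀ {A B} (f : Hom A B) → LinearIn₂ (D f)
  D-linearIn₂ f a b d = CD6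

  J : ∀ {A B} → Hom A B → Hom A (L A B)
  J f = λℓ (D f) (D-linearIn₂ f)

  p[_,_] : ∀ {A B} (f : Hom A B) → LinearIn₂ (f ∘ π₁ {⊤} {A}) → Hom ⊤ (L A B)
  p[ f , q ] = λℓ (f ∘ π₁) q

  ⊙-body : ∀ {A B C} → Hom ((L B C ⊗ L A B) ⊗ A) C
  ⊙-body = εℓ ∘ ⟨ π₀ ∘ π₀ , εℓ ∘ ⟨ π₁ ∘ π₀ , π₁ ⟩ ⟩

  ⊙[_] : ∀ {A B C} → LinearIn₂ (⊙-body {A} {B} {C}) → Hom (L B C ⊗ L A B) (L A C)
  ⊙[ q ] = λℓ ⊙-body q

-- The Jacobian J f is characterised by D f ≈ εℓ ∘ (J f ⊗₁ id) (uniqueness of the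
-- linear curry), so each identity follows by showing that the proposed right-hand
-- side h satisfies εℓ ∘ (h ⊗₁ id) ≈ D f. For (i) this is additivity of D and of
-- εℓ in its first argument; for (ii) a linear f has D f ≈ f ∘ π₁; for (iii) it is
-- the chain rule CD.5, with ⊙ uncurrying to composition of the two evaluations.
module Submission where

open import Defs
open import Data.Product using (_×_; _,_; proj₁)
open import Relation.Binary.Bundles using (Setoid)
import Relation.Binary.Reasoning.Setoid as SetoidReasoning

module CartesianLeftAdditiveProperties {o ℓ e} (𝒞 : CLACat o ℓ e) where
  open CLACat 𝒞

  hom-setoid : Obj → Obj → Setoid ℓ e
  hom-setoid A B = record { Carrier = Hom A B ; _≈_ = _≈_ ; isEquivalence = ≈-equiv }

  module _ {A B : Obj} where
    open Setoid (hom-setoid A B) public using () renaming (refl to ≈-refl; sym to ≈-sym; trans to ≈-trans)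
  module HomReasoning {A B : Obj} = SetoidReasoning (hom-setoid A B)
  open HomReasoning

  ∘-congˡ : ∀ {A B C} {f : Hom B C} {g g' : Hom A B} → g ≈ g' → f ∘ g ≈ f ∘ g'
  ∘-congˡ = ∘-resp-≈ ≈-refl

  ∘-congʳ : ∀ {A B C} {f f' : Hom B C} {g : Hom A B} → f ≈ f' → f ∘ g ≈ f' ∘ g
  ∘-congʳ p = ∘-resp-≈ p ≈-refl

  ⟨⟩-cong : ∀ {A B C} {f f' : Hom C A} {g g' : Hom C B} →
            f ≈ f' → g ≈ g' → ⟨ f , g ⟩ ≈ ⟨ f' , g' ⟩
  ⟨⟩-cong p q = ⟨⟩-unique (≈-trans π₀-β p) (≈-trans π₁-β q)

  ⟨⟩-∘ : ∀ {A B C X} {f : Hom C A} {g : Hom C B} {h : Hom X C} →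
         ⟨ f , g ⟩ ∘ h ≈ ⟨ f ∘ h , g ∘ h ⟩
  ⟨⟩-∘ {f = f} {g} {h} = ⟨⟩-unique
    (begin π₀ ∘ ⟨ f , g ⟩ ∘ h ≈⟨ assoc ⟨ (π₀ ∘ ⟨ f , g ⟩) ∘ h ≈⟨ ∘-congʳ π₀-β ⟩ f ∘ h ∎)
    (begin π₁ ∘ ⟨ f , g ⟩ ∘ h ≈⟨ assoc ⟨ (π₁ ∘ ⟨ f , g ⟩) ∘ h ≈⟨ ∘-congʳ π₁-β ⟩ g ∘ h ∎)

  ⟨⟩-+ : ∀ {A B C} {a c : Hom C A} {b d : Hom C B} →
         ⟨ a , b ⟩ + ⟨ c , d ⟩ ≈ ⟨ a + c , b + d ⟩
  ⟨⟩-+ = ⟨⟩-unique (≈-trans π₀-+ (+-resp-≈ π₀-β π₀-β)) (≈-trans π₁-+ (+-resp-≈ π₁-β π₁-β))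

  ⟨⟩-0 : ∀ {A B C} → ⟨ 0h , 0h ⟩ ≈ 0h {C} {A ⊗ B}
  ⟨⟩-0 = ≈-sym (⟨⟩-unique π₀-0 π₁-0)

  ⊗₁-∘-⟨⟩ : ∀ {A B C D X} {h : Hom A C} {k : Hom B D} {u : Hom X A} {v : Hom X B} →
            (h ⊗₁ k) ∘ ⟨ u , v ⟩ ≈ ⟨ h ∘ u , k ∘ v ⟩
  ⊗₁-∘-⟨⟩ {h = h} {k} {u} {v} = begin
    ⟨ h ∘ π₀ , k ∘ π₁ ⟩ ∘ ⟨ u , v ⟩                    ≈⟨ ⟨⟩-∘ ⟩
    ⟨ (h ∘ π₀) ∘ ⟨ u , v ⟩ , (k ∘ π₁) ∘ ⟨ u , v ⟩ ⟩   ≈⟨ ⟨⟩-cong assoc assoc ⟩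
    ⟨ h ∘ π₀ ∘ ⟨ u , v ⟩ , k ∘ π₁ ∘ ⟨ u , v ⟩ ⟩       ≈⟨ ⟨⟩-cong (∘-congˡ π₀-β) (∘-congˡ π₁-β) ⟩
    ⟨ h ∘ u , k ∘ v ⟩                                  ∎

  ⊗₁-∘-⊗₁ : ∀ {A B C D E F} {f : Hom C E} {g : Hom D F} {h : Hom A C} {k : Hom B D} →
            (f ⊗₁ g) ∘ (h ⊗₁ k) ≈ (f ∘ h) ⊗₁ (g ∘ k)
  ⊗₁-∘-⊗₁ = ≈-trans ⊗₁-∘-⟨⟩ (⟨⟩-cong (≈-sym assoc) (≈-sym assoc))

  π₁-∘-⊗₁-id : ∀ {A B C} {h : Hom A C} → π₁ ∘ (h ⊗₁ id {B}) ≈ π₁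
  π₁-∘-⊗₁-id = ≈-trans π₁-β identityˡ

module CartesianDifferentialProperties {o ℓ e} (𝒞 : CDC o ℓ e) where
  open CDC 𝒞
  open CartesianLeftAdditiveProperties cla
  open HomReasoning

  linear⇒D≈∘π₁ : ∀ {A B} {f : Hom A B} → IsLinear f → D f ≈ f ∘ π₁
  linear⇒D≈∘π₁ {f = f} linear = begin
    D f                ≈⟨ identityʳ ⟨
    D f ∘ id           ≈⟨ ∘-congˡ (⟨⟩-unique identityʳ identityʳ) ⟩
    D f ∘ ⟨ π₀ , π₁ ⟩  ≈⟨ linear π₀ π₁ ⟩
    f ∘ π₁             ∎

  -- Linearity in an argument is phrased through D, so additivity in it comes from CD.2.
  module _ {A B C} {f : Hom (A ⊗ B) C} (linear : LinearIn₁ f) {X} {b : Hom X B} where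

    linearIn₁-+ : ∀ {a c : Hom X A} → f ∘ ⟨ a + c , b ⟩ ≈ f ∘ ⟨ a , b ⟩ + f ∘ ⟨ c , b ⟩
    linearIn₁-+ {a} {c} = begin
      f ∘ ⟨ a + c , b ⟩                                                 ≈⟨ linear a (a + c) b ⟨
      D f ∘ ⟨ ⟨ a , b ⟩ , ⟨ a + c , 0h ⟩ ⟩                              ≈⟨ ∘-congˡ (⟨⟩-cong ≈-refl (⟨⟩-cong ≈-refl +-identityˡ)) ⟨
      D f ∘ ⟨ ⟨ a , b ⟩ , ⟨ a + c , 0h + 0h ⟩ ⟩                         ≈⟨ ∘-congˡ (⟨⟩-cong ≈-refl ⟨⟩-+) ⟨
      D f ∘ ⟨ ⟨ a , b ⟩ , ⟨ a , 0h ⟩ + ⟨ c , 0h ⟩ ⟩                     ≈⟨ CD2-+ ⟩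
      D f ∘ ⟨ ⟨ a , b ⟩ , ⟨ a , 0h ⟩ ⟩ + D f ∘ ⟨ ⟨ a , b ⟩ , ⟨ c , 0h ⟩ ⟩ ≈⟨ +-resp-≈ (linear a a b) (linear a c b) ⟩
      f ∘ ⟨ a , b ⟩ + f ∘ ⟨ c , b ⟩                                     ∎

    linearIn₁-0 : f ∘ ⟨ 0h , b ⟩ ≈ 0h
    linearIn₁-0 = begin
      f ∘ ⟨ 0h , b ⟩                         ≈⟨ linear 0h 0h b ⟨
      D f ∘ ⟨ ⟨ 0h , b ⟩ , ⟨ 0h , 0h ⟩ ⟩     ≈⟨ ∘-congˡ (⟨⟩-cong ≈-refl ⟨⟩-0) ⟩
      D f ∘ ⟨ ⟨ 0h , b ⟩ , 0h ⟩              ≈⟨ CD2-0 ⟩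
      0h                                     ∎

module LinearlyClosedProperties {o ℓ e} (𝒞 : LinClosedCDC o ℓ e) where
  open LinClosedCDC 𝒞
  open CartesianLeftAdditiveProperties cla
  open CartesianDifferentialProperties cdc
  open HomReasoning

  λℓ-∘-uncurry : ∀ {A A' B C} {f : Hom (A ⊗ B) C} (q : LinearIn₂ f) (h : Hom A' A) →
                 εℓ ∘ ((λℓ f q ∘ h) ⊗₁ id) ≈ f ∘ (h ⊗₁ id)
  λℓ-∘-uncurry {f = f} q h = begin
    εℓ ∘ ((λℓ f q ∘ h) ⊗₁ id)            ≈⟨ ∘-congˡ (⟨⟩-cong ≈-refl (∘-congʳ identityˡ)) ⟨
    εℓ ∘ ((λℓ f q ∘ h) ⊗₁ (id ∘ id))     ≈⟨ ∘-congˡ ⊗₁-∘-⊗₁ ⟨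
    εℓ ∘ (λℓ f q ⊗₁ id) ∘ (h ⊗₁ id)      ≈⟨ assoc ⟨
    (εℓ ∘ (λℓ f q ⊗₁ id)) ∘ (h ⊗₁ id)    ≈⟨ ∘-congʳ (λℓ-β f q) ⟨
    f ∘ (h ⊗₁ id)                        ∎

  J-β : ∀ {A B} (f : Hom A B) → D f ≈ εℓ ∘ (J f ⊗₁ id)
  J-β f = λℓ-β (D f) (D-linearIn₂ f)

  J-unique : ∀ {A B} {f : Hom A B} (h : Hom A (L A B)) → D f ≈ εℓ ∘ (h ⊗₁ id) → J f ≈ h
  J-unique {f = f} h p = ≈-sym (λℓ-unique (D f) (D-linearIn₂ f) h p)

  ⊙-body-∘-⊗₁ : ∀ {A B C X} {h : Hom X (L B C)} {k : Hom X (L A B)} →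
                ⊙-body ∘ (⟨ h , k ⟩ ⊗₁ id) ≈ εℓ ∘ ⟨ h ∘ π₀ , εℓ ∘ (k ⊗₁ id) ⟩
  ⊙-body-∘-⊗₁ {A} {B} {C} {X} {h} {k} = begin
    (εℓ ∘ ⟨ π₀ ∘ π₀ , εℓ ∘ ⟨ π₁ ∘ π₀ , π₁ ⟩ ⟩) ∘ H                ≈⟨ assoc ⟩
    εℓ ∘ ⟨ π₀ ∘ π₀ , εℓ ∘ ⟨ π₁ ∘ π₀ , π₁ ⟩ ⟩ ∘ H                  ≈⟨ ∘-congˡ ⟨⟩-∘ ⟩
    εℓ ∘ ⟨ (π₀ ∘ π₀) ∘ H , (εℓ ∘ ⟨ π₁ ∘ π₀ , π₁ ⟩) ∘ H ⟩          ≈⟨ ∘-congˡ (⟨⟩-cong (via-π₀ π₀-β) (≈-trans assoc (∘-congˡ ⟨⟩-∘))) ⟩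
    εℓ ∘ ⟨ h ∘ π₀ , εℓ ∘ ⟨ (π₁ ∘ π₀) ∘ H , π₁ ∘ H ⟩ ⟩            ≈⟨ ∘-congˡ (⟨⟩-cong ≈-refl (∘-congˡ (⟨⟩-cong (via-π₀ π₁-β) π₁-β))) ⟩
    εℓ ∘ ⟨ h ∘ π₀ , εℓ ∘ (k ⊗₁ id) ⟩                              ∎
    where
    H = ⟨ h , k ⟩ ⊗₁ id
    via-π₀ : ∀ {Y} {p : Hom (L B C ⊗ L A B) Y} {y : Hom X Y} → p ∘ ⟨ h , k ⟩ ≈ y →
                 (p ∘ π₀) ∘ H ≈ y ∘ π₀
    via-π₀ {p = p} {y} eq = begin
      (p ∘ π₀) ∘ H                ≈⟨ assoc ⟩
      p ∘ π₀ ∘ H                  ≈⟨ ∘-congˡ π₀-β ⟩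
      p ∘ ⟨ h , k ⟩ ∘ π₀          ≈⟨ assoc ⟨
      (p ∘ ⟨ h , k ⟩) ∘ π₀        ≈⟨ ∘-congʳ eq ⟩
      y ∘ π₀                      ∎

  J-+ : ∀ {A B} (f g : Hom A B) → J (f + g) ≈ J f + J g
  J-+ f g = J-unique (J f + J g) (begin
    D (f + g)                                                  ≈⟨ CD1-+ ⟩
    D f + D g                                                  ≈⟨ +-resp-≈ (J-β f) (J-β g) ⟩
    εℓ ∘ ⟨ J f ∘ π₀ , id ∘ π₁ ⟩ + εℓ ∘ ⟨ J g ∘ π₀ , id ∘ π₁ ⟩  ≈⟨ linearIn₁-+ (proj₁ εℓ-bilinear) ⟨
    εℓ ∘ ⟨ J f ∘ π₀ + J g ∘ π₀ , id ∘ π₁ ⟩                     ≈⟨ ∘-congˡ (⟨⟩-cong +-∘ ≈-refl) ⟨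
    εℓ ∘ ((J f + J g) ⊗₁ id)                                   ∎)

  J-0 : ∀ {A B} → J (0h {A} {B}) ≈ 0h
  J-0 = J-unique 0h (begin
    D 0h                          ≈⟨ CD1-0 ⟩
    0h                            ≈⟨ linearIn₁-0 (proj₁ εℓ-bilinear) ⟨
    εℓ ∘ ⟨ 0h , id ∘ π₁ ⟩         ≈⟨ ∘-congˡ (⟨⟩-cong 0-∘ ≈-refl) ⟨
    εℓ ∘ (0h ⊗₁ id)               ∎)

  J-linear : ∀ {A B} (f : Hom A B) → IsLinear f → (q : LinearIn₂ (f ∘ π₁ {⊤} {A})) →
             J f ≈ p[ f , q ] ∘ 0h
  J-linear f linear q = J-unique (p[ f , q ] ∘ 0h) (begin
    D f                             ≈⟨ linear⇒D≈∘π₁ linear ⟩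
    f ∘ π₁                          ≈⟨ ∘-congˡ π₁-∘-⊗₁-id ⟨
    f ∘ π₁ ∘ (0h ⊗₁ id)             ≈⟨ assoc ⟨
    (f ∘ π₁) ∘ (0h ⊗₁ id)           ≈⟨ λℓ-∘-uncurry q 0h ⟨
    εℓ ∘ ((p[ f , q ] ∘ 0h) ⊗₁ id)  ∎)

  J-∘ : ∀ {A B C} (f : Hom A B) (g : Hom B C) (q : LinearIn₂ (⊙-body {A} {B} {C})) →
        J (g ∘ f) ≈ ⊙[ q ] ∘ ⟨ J g ∘ f , J f ⟩
  J-∘ f g q = J-unique (⊙[ q ] ∘ ⟨ J g ∘ f , J f ⟩) (begin
    D (g ∘ f)                                      ≈⟨ CD5 ⟩
    D g ∘ ⟨ f ∘ π₀ , D f ⟩                         ≈⟨ ∘-congʳ (J-β g) ⟩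
    (εℓ ∘ (J g ⊗₁ id)) ∘ ⟨ f ∘ π₀ , D f ⟩          ≈⟨ assoc ⟩
    εℓ ∘ (J g ⊗₁ id) ∘ ⟨ f ∘ π₀ , D f ⟩            ≈⟨ ∘-congˡ ⊗₁-∘-⟨⟩ ⟩
    εℓ ∘ ⟨ J g ∘ f ∘ π₀ , id ∘ D f ⟩               ≈⟨ ∘-congˡ (⟨⟩-cong (≈-sym assoc) (≈-trans identityˡ (J-β f))) ⟩
    εℓ ∘ ⟨ (J g ∘ f) ∘ π₀ , εℓ ∘ (J f ⊗₁ id) ⟩     ≈⟨ ⊙-body-∘-⊗₁ ⟨
    ⊙-body ∘ (⟨ J g ∘ f , J f ⟩ ⊗₁ id)             ≈⟨ λℓ-∘-uncurry q (⟨ J g ∘ f , J f ⟩) ⟨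
    εℓ ∘ ((⊙[ q ] ∘ ⟨ J g ∘ f , J f ⟩) ⊗₁ id)      ∎)

mainTheorem2 : ∀ {o ℓ e} (𝒞 : LinClosedCDC o ℓ e) → let open LinClosedCDC 𝒞 in
    ((∀ {A B} (f g : Hom A B) → J (f + g) ≈ J f + J g)
      × (∀ {A B} → J (0h {A} {B}) ≈ 0h))
    × (∀ {A B} (f : Hom A B) → IsLinear f → (q : LinearIn₂ (f ∘ π₁ {⊤} {A})) →
         J f ≈ p[ f , q ] ∘ 0h {A} {⊤})
    × (∀ {A B C} (f : Hom A B) (g : Hom B C) (q : LinearIn₂ (⊙-body {A} {B} {C})) →
         J (g ∘ f) ≈ ⊙[ q ] ∘ ⟨ J g ∘ f , J f ⟩)
mainTheorem2 𝒞 = (J-+ , J-0) , J-linear , J-∘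
  where open LinearlyClosedProperties 𝒞
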